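{- Let $C_P \subset \mathbb{A}^2$ be the affine plane curve defined by $d_{2,P}(t,x) = x^4 + 2t^2x^2 - 8t^2x + t^4 - t(4x^3 - 4t^2x + 4t^2) = 0$. If $(t_0, x_0) \in \mathbb{Z}^2$ is a point on $C_P$, then $t_0$ is given by one of the following four formulas for some $n \in \mathbb{Z}$: (1) $t_0 = 64(u_{1,n}v_{1,n}^3 + 3v_{1,n}^4)$ with $u_{1,n} = \frac{(1+\sqrt{2})^{2n}+(1-\sqrt{2})^{2n}}{2}$, $v_{1,n} = \frac{(1+\sqrt{2})^{2n}-(1-\sqrt{2})^{2n}}{4\sqrt{2}}$; (2) $t_0 = 4(u_{2,n}v_{2,n}^3 + 3v_{2,n}^4)$ with $u_{2,n} = (1+\sqrt{2})^{2n+1}+(1-\sqrt{2})^{2n+1}$, $v_{2,n} = \frac{(1+\sqrt{2})^{2n+1}-(1-\sqrt{2})^{2n+1}}{2\sqrt{2}}$; (3) $t_0 = u_{3,n}v_{3,n}^3 + 3v_{3,n}^4$ with $u_{3,n} = \sqrt{2}\left((1+\sqrt{2})^{2n+1}-(1-\sqrt{2})^{2n+1}\right)$, $v_{3,n} = \frac{(1+\sqrt{2})^{2n+1}+(1-\sqrt{2})^{2n+1}}{2}$; (4) $t_0 = u_{4,n}v_{4,n}^3 + 3v_{4,n}^4$ with $u_{4,n} = \sqrt{2}\left((1+\sqrt{2})^{2n}-(1-\sqrt{2})^{2n}\right)$, $v_{4,n} = \frac{(1+\sqrt{2})^{2n}+(1-\sqrt{2})^{2n}}{2}$.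
   Context: The polynomial $d_{2,P}$ is the $2$-division polynomial of the point $P = (t,t)$ on the elliptic curve $y^2 = x^3 - t^2x + t^2$ over $\mathbb{Q}(t)$. -}

module Defs where

open import Data.Integer using (ℤ; +_; -[1+_]; _+_; _-_; _*_; -_; _^_)
open import Data.Nat using (ℕ; zero; suc)
open import Data.Product using (_×_; _,_)
open import Relation.Binary.PropositionalEquality using (_≡_; refl)

-- The 2-division polynomial d_{2,P}(t,x) of P = (t,t) on y^2 = x^3 - t^2 x + t^2.
d2P : ℤ → ℤ → ℤ
d2P t x = x ^ 4 + + 2 * t ^ 2 * x ^ 2 - + 8 * t ^ 2 * x + t ^ 4
          - t * (+ 4 * x ^ 3 - + 4 * t ^ 2 * x + + 4 * t ^ 2)

infix 4 _+√2·_
record ℤ√2 : Set where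
  constructor _+√2·_
  field
    re : ℤ
    im : ℤ
open ℤ√2 public

infixl 6 _⊕_ _⊖_
infixl 7 _⊗_

_⊕_ : ℤ√2 → ℤ√2 → ℤ√2
(a +√2· b) ⊕ (c +√2· d) = (a + c) +√2· (b + d)

_⊖_ : ℤ√2 → ℤ√2 → ℤ√2
(a +√2· b) ⊖ (c +√2· d) = (a - c) +√2· (b - d)

_⊗_ : ℤ√2 → ℤ√2 → ℤ√2
(a +√2· b) ⊗ (c +√2· d) = (a * c + + 2 * b * d) +√2· (a * d + b * c)

ι : ℤ → ℤ√2
ι a = a +√2· + 0

one√2 : ℤ√2
one√2 = ι (+ 1)

√2 : ℤ√2
√2 = + 0 +√2· + 1

_^ℕ_ : ℤ√2 → ℕ → ℤ√2
x ^ℕ zero = one√2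
x ^ℕ suc n = x ⊗ (x ^ℕ n)

zpow : ℤ√2 → ℤ√2 → ℤ → ℤ√2
zpow x xinv (+ n) = x ^ℕ n
zpow x xinv -[1+ n ] = xinv ^ℕ suc n

α α⁻¹ β β⁻¹ : ℤ√2
α = + 1 +√2· + 1
α⁻¹ = - + 1 +√2· + 1
β = + 1 +√2· - + 1
β⁻¹ = - + 1 +√2· - + 1

α-inv : (α ⊗ α⁻¹ ≡ one√2) × (α⁻¹ ⊗ α ≡ one√2)
α-inv = refl , refl

β-inv : (β ⊗ β⁻¹ ≡ one√2) × (β⁻¹ ⊗ β ≡ one√2)
β-inv = refl , refl

αpow : ℤ → ℤ√2
αpow = zpow α α⁻¹

βpow : ℤ → ℤ√2
βpow = zpow β β⁻¹

module Submission where

-- Write A = x² − 2tx − t². Then d_{2,P}(t,x) = A² − (2t)²(2x + t), so at an integral point with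
-- t ≠ 0 the rational s = A/(2t) has the integer square 2x + t and hence is an integer. The number
-- W = x + s² + 2s then satisfies W² = 2s²(s + 1)(s + 2), so W = sr with r² = 2(s + 1)(s + 2):
-- X + r√2 with X = 2s + 3 is a unit of norm 1 in ℤ[√2], and 4t = (X − 3)(3X − 1 − 4r).
-- By descent, the norm-one units are ±γP² with γ = 3 + 2√2 and P = (1 + √2)^M. Writing
-- P = p + q√2, the factorisation of 4t becomes 16q³(2p + 3q) when the sign agrees with the
-- norm (−1)^M of P and 4p³(3p + 4q) otherwise; the two signs and the two parities of M give
-- the four families (t = 0 lies in the first one, with n = 0).

module SquaresInℕ where

  open import Data.Nat
  open import Data.Nat.Properties
  open import Algebra.Properties.CommutativeSemigroup *-commutativeSemigroup using (interchange)
  open import Data.Nat.Divisibility using (_∣_; divides; ∣-refl; ∣-trans; 0∣⇒≡0; m∣m*n; *-cancelˡ-∣)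
  open import Data.Nat.Coprimality using (coprime-/gcd; coprime-divisor)
  import Data.Nat.Coprimality as Coprime
  open import Data.Nat.DivMod using (_/_; m*[n/m]≡n)
  open import Data.Nat.GCD using (gcd; gcd[m,n]∣m; gcd[m,n]∣n; gcd[m,n]≢0)
  open import Data.Nat.Tactic.RingSolver using (solve)
  open import Data.List using ([]; _∷_)
  open import Data.Product using (∃₂; _×_; _,_; proj₁; proj₂)
  open import Data.Sum using (inj₂; [_,_]′)
  open import Function using (id)
  open import Relation.Nullary using (yes; no; contradiction)
  open import Relation.Binary.PropositionalEquality

  *-self-cancel-≤ : ∀ {m n} → m * m ≤ n * n → m ≤ n
  *-self-cancel-≤ {m} {n} m²≤n² with m ≤? n
  ... | yes m≤n = m≤n
  ... | no m≰n = contradiction m²≤n² (<⇒≱ (*-mono-< n<m n<m))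
    where n<m = ≰⇒> m≰n

  *-self-cancel-< : ∀ {m n} → m * m < n * n → m < n
  *-self-cancel-< {m} {n} m²<n² with m <? n
  ... | yes m<n = m<n
  ... | no m≮n = contradiction m²<n² (≤⇒≯ (*-mono-≤ n≤m n≤m))
    where n≤m = ≮⇒≥ m≮n

  m*m∣n*n⇒m∣n : ∀ {m n} → m * m ∣ n * n → m ∣ n
  m*m∣n*n⇒m∣n {zero} {n} 0∣n² =
    subst (0 ∣_) (sym ([ id , id ]′ (m*n≡0⇒m≡0∨n≡0 n (0∣⇒≡0 0∣n²)))) ∣-refl
  m*m∣n*n⇒m∣n {m@(suc _)} {n} m²∣n² = subst (_∣ n) g≡m (gcd[m,n]∣m n m)
    where
    g = gcd n m
    instance
      _ : NonZero g
      _ = ≢-nonZero (gcd[m,n]≢0 n m (inj₂ (λ ())))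
    n′ = n / g
    m′ = m / g
    gn′≡n : g * n′ ≡ n
    gn′≡n = m*[n/m]≡n (gcd[m,n]∣m n m)
    gm′≡m : g * m′ ≡ m
    gm′≡m = m*[n/m]≡n (gcd[m,n]∣n n m)
    m′²∣n′² : m′ * m′ ∣ n′ * n′
    m′²∣n′² = *-cancelˡ-∣ (g * g) {{m*n≢0 g g}}
      (subst₂ _∣_ (trans (cong (λ k → k * k) (sym gm′≡m)) (interchange g m′ g m′))
                  (trans (cong (λ k → k * k) (sym gn′≡n)) (interchange g n′ g n′)) m²∣n²)
    m′∣n′ : m′ ∣ n′
    m′∣n′ = coprime-divisor (Coprime.sym (coprime-/gcd n m)) (∣-trans (m∣m*n m′) m′²∣n′²)
    g≡m : g ≡ m
    g≡m = trans (sym (*-identityʳ g))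
            (trans (cong (g *_) (sym (coprime-/gcd n m (m′∣n′ , ∣-refl)))) gm′≡m)

  n*n≢3 : ∀ n → n * n ≢ 3
  n*n≢3 0 ()
  n*n≢3 1 ()
  n*n≢3 n@(suc (suc _)) n²≡3 = <⇒≢ (*-mono-≤ {2} {n} (s≤s (s≤s z≤n)) (s≤s (s≤s z≤n))) (sym n²≡3)

  descent-inverse : ∀ {a b a′ b′} → 4 * b + a′ ≡ 3 * a → 2 * a + b′ ≡ 3 * b →
                    a ≡ 3 * a′ + 4 * b′ × b ≡ 3 * b′ + 2 * a′
  descent-inverse {a} {b} {a′} {b′} 4b+a′≡3a 2a+b′≡3b = a≡ , b≡
    where
    open ≡-Reasoning
    a≡ : a ≡ 3 * a′ + 4 * b′
    a≡ = +-cancelʳ-≡ (8 * a + 12 * b) a (3 * a′ + 4 * b′) (begin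
      a + (8 * a + 12 * b)                  ≡⟨ solve (a ∷ b ∷ []) ⟩
      3 * (3 * a) + 4 * (3 * b)             ≡⟨ cong₂ (λ x y → 3 * x + 4 * y) 4b+a′≡3a 2a+b′≡3b ⟨
      3 * (4 * b + a′) + 4 * (2 * a + b′)   ≡⟨ solve (a ∷ b ∷ a′ ∷ b′ ∷ []) ⟩
      3 * a′ + 4 * b′ + (8 * a + 12 * b)    ∎)
    b≡ : b ≡ 3 * b′ + 2 * a′
    b≡ = +-cancelʳ-≡ (6 * a + 8 * b) b (3 * b′ + 2 * a′) (begin
      b + (6 * a + 8 * b)                   ≡⟨ solve (a ∷ b ∷ []) ⟩
      3 * (3 * b) + 2 * (3 * a)             ≡⟨ cong₂ (λ x y → 3 * x + 2 * y) 2a+b′≡3b 4b+a′≡3a ⟨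
      3 * (2 * a + b′) + 2 * (4 * b + a′)   ≡⟨ solve (a ∷ b ∷ a′ ∷ b′ ∷ []) ⟩
      3 * b′ + 2 * a′ + (6 * a + 8 * b)     ∎)

  descent-preserves-pell : ∀ {a b a′ b′} → a ≡ 3 * a′ + 4 * b′ → b ≡ 3 * b′ + 2 * a′ →
                           a * a ≡ 1 + 2 * (b * b) → a′ * a′ ≡ 1 + 2 * (b′ * b′)
  descent-preserves-pell {a} {b} {a′} {b′} a≡ b≡ pell =
    +-cancelʳ-≡ (8 * (a′ * a′) + 24 * (a′ * b′) + 16 * (b′ * b′)) _ _ (begin
      a′ * a′ + (8 * (a′ * a′) + 24 * (a′ * b′) + 16 * (b′ * b′))
        ≡⟨ solve (a′ ∷ b′ ∷ []) ⟩
      (3 * a′ + 4 * b′) * (3 * a′ + 4 * b′)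
        ≡⟨ cong (λ x → x * x) a≡ ⟨
      a * a
        ≡⟨ pell ⟩
      1 + 2 * (b * b)
        ≡⟨ cong (λ y → 1 + 2 * (y * y)) b≡ ⟩
      1 + 2 * ((3 * b′ + 2 * a′) * (3 * b′ + 2 * a′))
        ≡⟨ solve (a′ ∷ b′ ∷ []) ⟩
      1 + 2 * (b′ * b′) + (8 * (a′ * a′) + 24 * (a′ * b′) + 16 * (b′ * b′)) ∎)
    where open ≡-Reasoning

  module _ {a b : ℕ} (pell : a * a ≡ 1 + 2 * (b * b)) where
    open ≤-Reasoning

    pell-b<a : b < a
    pell-b<a = *-self-cancel-< (subst (b * b <_) (sym pell) (s≤s (m≤n*m (b * b) 2)))

    pell-4b≤3a : 4 * b ≤ 3 * a
    pell-4b≤3a = *-self-cancel-≤ (begin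
      (4 * b) * (4 * b)                ≡⟨ solve (b ∷ []) ⟩
      16 * (b * b)                     ≤⟨ m≤m+n _ _ ⟩
      16 * (b * b) + (9 + 2 * (b * b)) ≡⟨ solve (b ∷ []) ⟩
      9 * (1 + 2 * (b * b))            ≡⟨ cong (9 *_) pell ⟨
      9 * (a * a)                      ≡⟨ solve (a ∷ []) ⟩
      (3 * a) * (3 * a)                ∎)

    pell-2a≤3b : 2 ≤ b → 2 * a ≤ 3 * b
    pell-2a≤3b 2≤b = *-self-cancel-≤ (begin
      (2 * a) * (2 * a)                ≡⟨ solve (a ∷ []) ⟩
      4 * (a * a)                      ≡⟨ cong (4 *_) pell ⟩
      4 * (1 + 2 * (b * b))            ≡⟨ solve (b ∷ []) ⟩
      4 + 8 * (b * b)                  ≤⟨ +-monoˡ-≤ (8 * (b * b)) (*-mono-≤ 2≤b 2≤b) ⟩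
      b * b + 8 * (b * b)              ≡⟨ solve (b ∷ []) ⟩
      (3 * b) * (3 * b)                ∎)

    pell-descent : 2 ≤ b →
      ∃₂ λ a′ b′ → b′ < b × a ≡ 3 * a′ + 4 * b′ × b ≡ 3 * b′ + 2 * a′ × a′ * a′ ≡ 1 + 2 * (b′ * b′)
    pell-descent 2≤b = a′ , b′ , b′<b , a≡ , b≡ , descent-preserves-pell {a′ = a′} {b′} a≡ b≡ pell
      where
      -- a′ + b′√2 = (a + b√2)(3 − 2√2), the quotient by γ = 3 + 2√2.
      a′ = 3 * a ∸ 4 * b
      b′ = 3 * b ∸ 2 * a
      2a+b′≡3b : 2 * a + b′ ≡ 3 * b
      2a+b′≡3b = m+[n∸m]≡n (pell-2a≤3b 2≤b)
      inverse = descent-inverse {a′ = a′} {b′} (m+[n∸m]≡n pell-4b≤3a) 2a+b′≡3b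
      a≡ = proj₁ inverse
      b≡ = proj₂ inverse
      b′<b : b′ < b
      b′<b = +-cancelˡ-< (2 * a) b′ b (begin-strict
        2 * a + b′  ≡⟨ 2a+b′≡3b ⟩
        3 * b       ≡⟨ solve (b ∷ []) ⟩
        2 * b + b   <⟨ +-monoˡ-< b (*-monoʳ-< 2 pell-b<a) ⟩
        2 * a + b   ∎)

open import Defs
open import Data.Integer using (ℤ; +_; _+_; _*_; _^_)
open import Data.Product using (∃; _×_)
open import Data.Sum using (_⊎_)
open import Relation.Binary.PropositionalEquality using (_≡_)

open import Data.Integer as ℤ using (-[1+_]; +0; +[1+_]; _-_; -_; ∣_∣)
import Data.Integer.Properties as ℤ
open import Algebra.Properties.CommutativeSemigroup ℤ.*-commutativeSemigroup using (interchange)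
import Data.Integer.DivMod as ℤ
import Data.Integer.Divisibility.Signed as ℤ
open import Data.Integer.Tactic.RingSolver as ℤ-Solver using ()
open import Data.Nat as ℕ using (zero; suc; z≤n; s≤s)
import Data.Nat.Properties as ℕ
open import Data.Nat.Divisibility using (divides)
open import Data.Nat.Induction using (<-rec)
open import Data.List using ([]; _∷_)
open import Data.Product using (_,_; _,′_; proj₁)
open import Data.Sum using (inj₁; inj₂; [_,_]′)
open import Function using (id; _∘_; case_of_)
open import Relation.Nullary using (yes; no; contradiction)
open import Relation.Binary.PropositionalEquality using (_≢_; refl; sym; trans; cong; cong₂; module ≡-Reasoning)
open ≡-Reasoning
open SquaresInℕ using (m*m∣n*n⇒m∣n; n*n≢3; pell-descent)

2*+i : ∀ i → + 2 * + i ≡ + (i ℕ.+ i)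
2*+i i = trans (sym (ℤ.pos-* 2 i)) (cong (λ k → + (i ℕ.+ k)) (ℕ.+-identityʳ i))

2*-[1+i] : ∀ i → + 2 * -[1+ i ] ≡ -[1+ (i ℕ.+ suc i) ]
2*-[1+i] i = cong (λ k → -[1+ (i ℕ.+ k) ]) (ℕ.+-identityʳ (suc i))

∣i∣≡1⇒i*i≡1 : ∀ i → ∣ i ∣ ≡ 1 → i * i ≡ + 1
∣i∣≡1⇒i*i≡1 (+[1+ zero ]) _ = refl
∣i∣≡1⇒i*i≡1 (-[1+ zero ]) _ = refl
∣i∣≡1⇒i*i≡1 (+0) ()
∣i∣≡1⇒i*i≡1 (+[1+ suc _ ]) ()
∣i∣≡1⇒i*i≡1 (-[1+ suc _ ]) ()

square-abs : ∀ i → i * i ≡ + ∣ i ∣ * + ∣ i ∣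
square-abs (+ n) = refl
square-abs -[1+ n ] = refl

square-quotient : ∀ A B W .{{_ : ℤ.NonZero B}} → A * A ≡ (B * B) * W →
                  ∃ λ C → A ≡ B * C × C * C ≡ W
square-quotient A B W A²≡B²W with ℤ.∣ᵤ⇒∣ {B} {A} (m*m∣n*n⇒m∣n (divides ∣ W ∣ ∣A∣²≡∣W∣∣B∣²))
  where
  ∣A∣²≡∣W∣∣B∣² : ∣ A ∣ ℕ.* ∣ A ∣ ≡ ∣ W ∣ ℕ.* (∣ B ∣ ℕ.* ∣ B ∣)
  ∣A∣²≡∣W∣∣B∣² = begin
    ∣ A ∣ ℕ.* ∣ A ∣              ≡⟨ ℤ.abs-* A A ⟨
    ∣ A * A ∣                    ≡⟨ cong ∣_∣ A²≡B²W ⟩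
    ∣ B * B * W ∣                ≡⟨ ℤ.abs-* (B * B) W ⟩
    ∣ B * B ∣ ℕ.* ∣ W ∣          ≡⟨ cong (ℕ._* ∣ W ∣) (ℤ.abs-* B B) ⟩
    ∣ B ∣ ℕ.* ∣ B ∣ ℕ.* ∣ W ∣    ≡⟨ ℕ.*-comm _ ∣ W ∣ ⟩
    ∣ W ∣ ℕ.* (∣ B ∣ ℕ.* ∣ B ∣)  ∎
... | ℤ.divides C A≡CB = C , A≡BC , C²≡W
  where
  A≡BC : A ≡ B * C
  A≡BC = trans A≡CB (ℤ.*-comm C B)
  C²≡W : C * C ≡ W
  C²≡W = ℤ.*-cancelˡ-≡ (B * B) (C * C) W {{ℤ.i*j≢0 B B}} (begin
    (B * B) * (C * C)  ≡⟨ interchange B C B C ⟨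
    (B * C) * (B * C)  ≡⟨ cong (λ k → k * k) A≡BC ⟨
    A * A              ≡⟨ A²≡B²W ⟩
    (B * B) * W        ∎)

parity : ∀ M → ∃ λ n → M ≡ + 2 * n ⊎ M ≡ + 2 * n + + 1
parity M = by-remainder (ℤ.n%ℕd<d M 2) (ℤ.a≡a%ℕn+[a/ℕn]*n M 2)
  where
  by-remainder : ∀ {r} → r ℕ.< 2 → M ≡ + r + (M ℤ./ℕ 2) * + 2 → ∃ λ n → M ≡ + 2 * n ⊎ M ≡ + 2 * n + + 1
  by-remainder {0} _ M≡ = M ℤ./ℕ 2 , inj₁ (trans M≡ (even (M ℤ./ℕ 2)))
    where
    even : ∀ n → + 0 + n * + 2 ≡ + 2 * n
    even = ℤ-Solver.solve-∀
  by-remainder {1} _ M≡ = M ℤ./ℕ 2 , inj₂ (trans M≡ (odd (M ℤ./ℕ 2)))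
    where
    odd : ∀ n → + 1 + n * + 2 ≡ + 2 * n + + 1
    odd = ℤ-Solver.solve-∀
  by-remainder {suc (suc _)} (s≤s (s≤s ())) _

-- The ring ℤ[√2]

γ γ⁻¹ : ℤ√2
γ = α ⊗ α
γ⁻¹ = α⁻¹ ⊗ α⁻¹

conj neg : ℤ√2 → ℤ√2
conj (a +√2· b) = a +√2· (- b)
neg (a +√2· b) = (- a) +√2· (- b)

nrm : ℤ√2 → ℤ
nrm (a +√2· b) = a * a - + 2 * b * b

⊗-comm : ∀ x y → x ⊗ y ≡ y ⊗ x
⊗-comm (a +√2· b) (c +√2· d) =
  cong₂ _+√2·_ (ℤ-Solver.solve (a ∷ b ∷ c ∷ d ∷ [])) (ℤ-Solver.solve (a ∷ b ∷ c ∷ d ∷ []))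

⊗-assoc : ∀ x y z → (x ⊗ y) ⊗ z ≡ x ⊗ (y ⊗ z)
⊗-assoc (a +√2· b) (c +√2· d) (e +√2· f) = cong₂ _+√2·_ (re-assoc a b c d e f) (im-assoc a b c d e f)
  where
  re-assoc : ∀ a b c d e f → (a * c + + 2 * b * d) * e + + 2 * (a * d + b * c) * f
                           ≡ a * (c * e + + 2 * d * f) + + 2 * b * (c * f + d * e)
  re-assoc = ℤ-Solver.solve-∀
  im-assoc : ∀ a b c d e f → (a * c + + 2 * b * d) * f + (a * d + b * c) * e
                           ≡ a * (c * f + d * e) + b * (c * e + + 2 * d * f)
  im-assoc = ℤ-Solver.solve-∀

⊗-identityˡ : ∀ x → one√2 ⊗ x ≡ x
⊗-identityˡ (a +√2· b) = cong₂ _+√2·_ (ℤ-Solver.solve (a ∷ b ∷ [])) (ℤ-Solver.solve (a ∷ b ∷ []))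

⊗-cancelˡ : ∀ {x y} → x ⊗ y ≡ one√2 → ∀ z → x ⊗ (y ⊗ z) ≡ z
⊗-cancelˡ {x} {y} xy≡1 z = begin
  x ⊗ (y ⊗ z)  ≡⟨ ⊗-assoc x y z ⟨
  (x ⊗ y) ⊗ z  ≡⟨ cong (_⊗ z) xy≡1 ⟩
  one√2 ⊗ z    ≡⟨ ⊗-identityˡ z ⟩
  z            ∎

⊗-interchange : ∀ w x y z → (w ⊗ x) ⊗ (y ⊗ z) ≡ (w ⊗ y) ⊗ (x ⊗ z)
⊗-interchange w x y z = begin
  (w ⊗ x) ⊗ (y ⊗ z)  ≡⟨ ⊗-assoc w x (y ⊗ z) ⟩
  w ⊗ (x ⊗ (y ⊗ z))  ≡⟨ cong (w ⊗_) (⊗-assoc x y z) ⟨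
  w ⊗ ((x ⊗ y) ⊗ z)  ≡⟨ cong (λ v → w ⊗ (v ⊗ z)) (⊗-comm x y) ⟩
  w ⊗ ((y ⊗ x) ⊗ z)  ≡⟨ cong (w ⊗_) (⊗-assoc y x z) ⟩
  w ⊗ (y ⊗ (x ⊗ z))  ≡⟨ ⊗-assoc w y (x ⊗ z) ⟨
  (w ⊗ y) ⊗ (x ⊗ z)  ∎

conj-⊗ : ∀ x y → conj (x ⊗ y) ≡ conj x ⊗ conj y
conj-⊗ (a +√2· b) (c +√2· d) = cong₂ _+√2·_ (re-conj a b c d) (im-conj a b c d)
  where
  re-conj : ∀ a b c d → a * c + + 2 * b * d ≡ a * c + + 2 * (- b) * (- d)
  re-conj = ℤ-Solver.solve-∀
  im-conj : ∀ a b c d → - (a * d + b * c) ≡ a * (- d) + (- b) * c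
  im-conj = ℤ-Solver.solve-∀

nrm-⊗ : ∀ x y → nrm (x ⊗ y) ≡ nrm x * nrm y
nrm-⊗ (a +√2· b) (c +√2· d) = brahmagupta a b c d
  where
  brahmagupta : ∀ a b c d →
    (a * c + + 2 * b * d) * (a * c + + 2 * b * d) - + 2 * (a * d + b * c) * (a * d + b * c)
    ≡ (a * a - + 2 * b * b) * (c * c - + 2 * d * d)
  brahmagupta = ℤ-Solver.solve-∀

^ℕ-+ : ∀ x m n → x ^ℕ (m ℕ.+ n) ≡ x ^ℕ m ⊗ x ^ℕ n
^ℕ-+ x zero n = sym (⊗-identityˡ (x ^ℕ n))
^ℕ-+ x (suc m) n = trans (cong (x ⊗_) (^ℕ-+ x m n)) (sym (⊗-assoc x (x ^ℕ m) (x ^ℕ n)))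

^ℕ-distrib-⊗ : ∀ x y n → (x ⊗ y) ^ℕ n ≡ x ^ℕ n ⊗ y ^ℕ n
^ℕ-distrib-⊗ x y zero = refl
^ℕ-distrib-⊗ x y (suc n) =
  trans (cong ((x ⊗ y) ⊗_) (^ℕ-distrib-⊗ x y n)) (⊗-interchange x y (x ^ℕ n) (y ^ℕ n))

conj-^ℕ : ∀ x n → conj (x ^ℕ n) ≡ conj x ^ℕ n
conj-^ℕ x zero = refl
conj-^ℕ x (suc n) = trans (conj-⊗ x (x ^ℕ n)) (cong (conj x ⊗_) (conj-^ℕ x n))

∣nrm-^ℕ∣ : ∀ x → ∣ nrm x ∣ ≡ 1 → ∀ n → ∣ nrm (x ^ℕ n) ∣ ≡ 1
∣nrm-^ℕ∣ _ _ zero = refl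
∣nrm-^ℕ∣ x ∣nrm-x∣≡1 (suc n) = begin
  ∣ nrm (x ⊗ x ^ℕ n) ∣               ≡⟨ cong ∣_∣ (nrm-⊗ x (x ^ℕ n)) ⟩
  ∣ nrm x * nrm (x ^ℕ n) ∣           ≡⟨ ℤ.abs-* (nrm x) (nrm (x ^ℕ n)) ⟩
  ∣ nrm x ∣ ℕ.* ∣ nrm (x ^ℕ n) ∣     ≡⟨ cong₂ ℕ._*_ ∣nrm-x∣≡1 (∣nrm-^ℕ∣ x ∣nrm-x∣≡1 n) ⟩
  1                                  ∎

⊕-conj : ∀ z → z ⊕ conj z ≡ ι (+ 2 * re z)
⊕-conj (a +√2· b) = cong₂ _+√2·_ (double a) (ℤ.+-inverseʳ b)
  where
  double : ∀ a → a + a ≡ + 2 * a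
  double = ℤ-Solver.solve-∀

⊖-conj : ∀ z → z ⊖ conj z ≡ √2 ⊗ ι (+ 2 * im z)
⊖-conj (a +√2· b) = cong₂ _+√2·_ (re-diff a b) (im-diff b)
  where
  re-diff : ∀ a b → a - a ≡ + 0 * (+ 2 * b) + + 2 * + 1 * + 0
  re-diff = ℤ-Solver.solve-∀
  im-diff : ∀ b → b - - b ≡ + 0 * + 0 + + 1 * (+ 2 * b)
  im-diff = ℤ-Solver.solve-∀

ι-⊗-ι : ∀ a b → ι a ⊗ ι b ≡ ι (a * b)
ι-⊗-ι a b = cong₂ _+√2·_ (re-ι a b) (im-ι a b)
  where
  re-ι : ∀ a b → a * b + + 2 * + 0 * + 0 ≡ a * b
  re-ι = ℤ-Solver.solve-∀
  im-ι : ∀ a b → a * + 0 + + 0 * b ≡ + 0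
  im-ι = ℤ-Solver.solve-∀

ι-⊗-√2-⊗-ι : ∀ a b → ι a ⊗ √2 ⊗ ι b ≡ √2 ⊗ ι (a * b)
ι-⊗-√2-⊗-ι a b = begin
  (ι a ⊗ √2) ⊗ ι b   ≡⟨ cong (_⊗ ι b) (⊗-comm (ι a) √2) ⟩
  (√2 ⊗ ι a) ⊗ ι b   ≡⟨ ⊗-assoc √2 (ι a) (ι b) ⟩
  √2 ⊗ (ι a ⊗ ι b)   ≡⟨ cong (√2 ⊗_) (ι-⊗-ι a b) ⟩
  √2 ⊗ ι (a * b)     ∎

√2-⊗-√2-⊗-ι : ∀ a → √2 ⊗ (√2 ⊗ ι a) ≡ ι (+ 2 * a)
√2-⊗-√2-⊗-ι a = trans (sym (⊗-assoc √2 √2 (ι a))) (ι-⊗-ι (+ 2) a)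

-- Powers of 1 + √2

βpow≡conj-αpow : ∀ M → βpow M ≡ conj (αpow M)
βpow≡conj-αpow (+ n) = sym (conj-^ℕ α n)
βpow≡conj-αpow -[1+ n ] = sym (conj-^ℕ α⁻¹ (suc n))

αpow-double : ∀ n → αpow (+ 2 * n) ≡ αpow n ⊗ αpow n
αpow-double (+ i) = trans (cong αpow (2*+i i)) (^ℕ-+ α i i)
αpow-double -[1+ i ] = trans (cong αpow (2*-[1+i] i)) (^ℕ-+ α⁻¹ (suc i) (suc i))

αpow-odd : ∀ n → αpow (+ 2 * n + + 1) ≡ α ⊗ αpow (+ 2 * n)
αpow-odd (+ i) = begin
  αpow (+ 2 * + i + + 1)      ≡⟨ cong (λ k → αpow (k + + 1)) (2*+i i) ⟩
  α ^ℕ (i ℕ.+ i ℕ.+ 1)        ≡⟨ cong (α ^ℕ_) (ℕ.+-comm (i ℕ.+ i) 1) ⟩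
  α ⊗ α ^ℕ (i ℕ.+ i)          ≡⟨ cong (λ k → α ⊗ αpow k) (2*+i i) ⟨
  α ⊗ αpow (+ 2 * + i)        ∎
αpow-odd -[1+ i ] = begin
  αpow (+ 2 * -[1+ i ] + + 1)          ≡⟨ cong (λ k → αpow (k + + 1)) (2*-[1+i] i) ⟩
  αpow (-[1+ (i ℕ.+ suc i) ] + + 1)    ≡⟨ cong (λ k → αpow (-[1+ k ] + + 1)) (ℕ.+-suc i i) ⟩
  α⁻¹ ^ℕ suc (i ℕ.+ i)                 ≡⟨ ⊗-cancelˡ {α} {α⁻¹} (proj₁ α-inv) _ ⟨
  α ⊗ α⁻¹ ^ℕ suc (suc (i ℕ.+ i))       ≡⟨ cong (λ k → α ⊗ α⁻¹ ^ℕ suc k) (ℕ.+-suc i i) ⟨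
  α ⊗ α⁻¹ ^ℕ suc (i ℕ.+ suc i)         ≡⟨ cong (λ k → α ⊗ αpow k) (2*-[1+i] i) ⟨
  α ⊗ αpow (+ 2 * -[1+ i ])            ∎

∣nrm-αpow∣ : ∀ M → ∣ nrm (αpow M) ∣ ≡ 1
∣nrm-αpow∣ (+ n) = ∣nrm-^ℕ∣ α refl n
∣nrm-αpow∣ -[1+ n ] = ∣nrm-^ℕ∣ α⁻¹ refl (suc n)

nrm-αpow-even : ∀ n → nrm (αpow (+ 2 * n)) ≡ + 1
nrm-αpow-even n = begin
  nrm (αpow (+ 2 * n))               ≡⟨ cong nrm (αpow-double n) ⟩
  nrm (αpow n ⊗ αpow n)              ≡⟨ nrm-⊗ (αpow n) (αpow n) ⟩
  nrm (αpow n) * nrm (αpow n)        ≡⟨ ∣i∣≡1⇒i*i≡1 (nrm (αpow n)) (∣nrm-αpow∣ n) ⟩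
  + 1                                ∎

nrm-αpow-odd : ∀ n → nrm (αpow (+ 2 * n + + 1)) ≡ - + 1
nrm-αpow-odd n = begin
  nrm (αpow (+ 2 * n + + 1))         ≡⟨ cong nrm (αpow-odd n) ⟩
  nrm (α ⊗ αpow (+ 2 * n))           ≡⟨ nrm-⊗ α (αpow (+ 2 * n)) ⟩
  nrm α * nrm (αpow (+ 2 * n))       ≡⟨ cong (nrm α *_) (nrm-αpow-even n) ⟩
  - + 1                              ∎

im-αpow-even : ∀ n → im (αpow (+ 2 * n)) ≡ + 2 * (re (αpow n) * im (αpow n))
im-αpow-even n = trans (cong im (αpow-double n)) (im-square (re (αpow n)) (im (αpow n)))
  where
  im-square : ∀ a b → a * b + b * a ≡ + 2 * (a * b)
  im-square = ℤ-Solver.solve-∀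

αpow-⊕-βpow : ∀ M → αpow M ⊕ βpow M ≡ ι (+ 2 * re (αpow M))
αpow-⊕-βpow M = trans (cong (αpow M ⊕_) (βpow≡conj-αpow M)) (⊕-conj (αpow M))

αpow-⊖-βpow : ∀ M → αpow M ⊖ βpow M ≡ √2 ⊗ ι (+ 2 * im (αpow M))
αpow-⊖-βpow M = trans (cong (αpow M ⊖_) (βpow≡conj-αpow M)) (⊖-conj (αpow M))

-- Norm-one units

γ-⊗-ℕ : ∀ m n → γ ⊗ (+ m +√2· + n) ≡ (+ (3 ℕ.* m ℕ.+ 4 ℕ.* n) +√2· + (3 ℕ.* n ℕ.+ 2 ℕ.* m))
γ-⊗-ℕ m n = sym (cong₂ _+√2·_ (pos-linear 3 m 4 n) (pos-linear 3 n 2 m))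
  where
  pos-linear : ∀ a m b n → + (a ℕ.* m ℕ.+ b ℕ.* n) ≡ + a * + m + + b * + n
  pos-linear a m b n = trans (ℤ.pos-+ (a ℕ.* m) (b ℕ.* n)) (cong₂ _+_ (ℤ.pos-* a m) (ℤ.pos-* b n))

pell-ℕ⇒γ^ℕ : ∀ b a → a ℕ.* a ≡ 1 ℕ.+ 2 ℕ.* (b ℕ.* b) → ∃ λ k → (+ a +√2· + b) ≡ γ ^ℕ k
pell-ℕ⇒γ^ℕ = <-rec _ solution
  where
  solution : ∀ b → (∀ {b′} → b′ ℕ.< b → ∀ a′ → a′ ℕ.* a′ ≡ 1 ℕ.+ 2 ℕ.* (b′ ℕ.* b′) →
                                         ∃ λ k → (+ a′ +√2· + b′) ≡ γ ^ℕ k) →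
             ∀ a → a ℕ.* a ≡ 1 ℕ.+ 2 ℕ.* (b ℕ.* b) → ∃ λ k → (+ a +√2· + b) ≡ γ ^ℕ k
  solution 0 _ a a²≡1 = 0 , cong (λ n → + n +√2· + 0) (ℕ.m*n≡1⇒m≡1 a a a²≡1)
  solution 1 _ a a²≡3 = contradiction a²≡3 (n*n≢3 a)
  solution b@(suc (suc _)) smaller a pell = case pell-descent pell (s≤s (s≤s z≤n)) of λ where
    (a′ , b′ , b′<b , a≡ , b≡ , pell′) → case smaller b′<b a′ pell′ of λ where
      (k , a′+b′√2≡γ^k) → suc k , (begin
        (+ a +√2· + b)                                            ≡⟨ cong₂ (λ m n → + m +√2· + n) a≡ b≡ ⟩
        (+ (3 ℕ.* a′ ℕ.+ 4 ℕ.* b′) +√2· + (3 ℕ.* b′ ℕ.+ 2 ℕ.* a′)) ≡⟨ γ-⊗-ℕ a′ b′ ⟨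
        γ ⊗ (+ a′ +√2· + b′)                                      ≡⟨ cong (γ ⊗_) a′+b′√2≡γ^k ⟩
        γ ⊗ γ ^ℕ k                                                ∎)

nrm≡1⇒pell-ℕ : ∀ X Y → nrm (X +√2· Y) ≡ + 1 → ∣ X ∣ ℕ.* ∣ X ∣ ≡ 1 ℕ.+ 2 ℕ.* (∣ Y ∣ ℕ.* ∣ Y ∣)
nrm≡1⇒pell-ℕ X Y nrm≡1 = ℤ.+-injective (begin
  + (∣ X ∣ ℕ.* ∣ X ∣)                    ≡⟨ ℤ.pos-* ∣ X ∣ ∣ X ∣ ⟩
  + ∣ X ∣ * + ∣ X ∣                      ≡⟨ square-abs X ⟨
  X * X                                  ≡⟨ ℤ-Solver.solve (X ∷ Y ∷ []) ⟩
  (X * X - + 2 * Y * Y) + + 2 * (Y * Y)  ≡⟨ cong₂ (λ n y → n + + 2 * y) nrm≡1 (square-abs Y) ⟩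
  + 1 + + 2 * (+ ∣ Y ∣ * + ∣ Y ∣)        ≡⟨ cong (λ y → + 1 + + 2 * y) (ℤ.pos-* ∣ Y ∣ ∣ Y ∣) ⟨
  + 1 + + 2 * + (∣ Y ∣ ℕ.* ∣ Y ∣)        ≡⟨ cong (_+_ (+ 1)) (ℤ.pos-* 2 (∣ Y ∣ ℕ.* ∣ Y ∣)) ⟨
  + (1 ℕ.+ 2 ℕ.* (∣ Y ∣ ℕ.* ∣ Y ∣))      ∎)

γ^ℕ-as-γ-square : ∀ k → ∃ λ M → γ ^ℕ k ≡ γ ⊗ (αpow M ⊗ αpow M)
γ^ℕ-as-γ-square zero = -[1+ 0 ] , refl
γ^ℕ-as-γ-square (suc k) = + k , cong (γ ⊗_) (^ℕ-distrib-⊗ α α k)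

conj-γ^ℕ-as-γ-square : ∀ k → conj (γ ^ℕ k) ≡ γ ⊗ (αpow -[1+ k ] ⊗ αpow -[1+ k ])
conj-γ^ℕ-as-γ-square k = begin
  conj (γ ^ℕ k)                       ≡⟨ conj-^ℕ γ k ⟩
  γ⁻¹ ^ℕ k                            ≡⟨ ⊗-cancelˡ {γ} {γ⁻¹} refl (γ⁻¹ ^ℕ k) ⟨
  γ ⊗ γ⁻¹ ^ℕ suc k                    ≡⟨ cong (γ ⊗_) (^ℕ-distrib-⊗ α⁻¹ α⁻¹ (suc k)) ⟩
  γ ⊗ (α⁻¹ ^ℕ suc k ⊗ α⁻¹ ^ℕ suc k)   ∎

nrm≡1⇒±γ-square : ∀ z → nrm z ≡ + 1 →
  ∃ λ M → z ≡ γ ⊗ (αpow M ⊗ αpow M) ⊎ z ≡ neg (γ ⊗ (αpow M ⊗ αpow M))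
nrm≡1⇒±γ-square (X +√2· Y) nrm≡1 = by-signs X Y (pell-ℕ⇒γ^ℕ ∣ Y ∣ ∣ X ∣ (nrm≡1⇒pell-ℕ X Y nrm≡1))
  where
  by-signs : ∀ X Y → ∃ (λ k → (+ ∣ X ∣ +√2· + ∣ Y ∣) ≡ γ ^ℕ k) →
    ∃ λ M → (X +√2· Y) ≡ γ ⊗ (αpow M ⊗ αpow M) ⊎ (X +√2· Y) ≡ neg (γ ⊗ (αpow M ⊗ αpow M))
  by-signs (+ _) (+ _) (k , eq) =
    let M , γ^k≡ = γ^ℕ-as-γ-square k in M , inj₁ (trans eq γ^k≡)
  by-signs -[1+ _ ] -[1+ _ ] (k , eq) =
    let M , γ^k≡ = γ^ℕ-as-γ-square k in M , inj₂ (cong neg (trans eq γ^k≡))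
  by-signs (+ _) -[1+ _ ] (k , eq) =
    -[1+ k ] , inj₁ (trans (cong conj eq) (conj-γ^ℕ-as-γ-square k))
  by-signs -[1+ a ] (+ b) (k , eq) = -[1+ k ] , inj₂ (begin
    (-[1+ a ] +√2· + b)           ≡⟨ cong (-[1+ a ] +√2·_) (ℤ.neg-involutive (+ b)) ⟨
    neg (conj (+ suc a +√2· + b))  ≡⟨ cong (neg ∘ conj) eq ⟩
    neg (conj (γ ^ℕ k))            ≡⟨ cong neg (conj-γ^ℕ-as-γ-square k) ⟩
    neg (γ ⊗ (αpow -[1+ k ] ⊗ αpow -[1+ k ]))  ∎)

-- From an integral point to a norm-one unit

d2P-difference-of-squares : ∀ t x → d2P t x ≡
  (x * x - + 2 * t * x - t * t) * (x * x - + 2 * t * x - t * t) - (+ 2 * t) * (+ 2 * t) * (+ 2 * x + t)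
d2P-difference-of-squares = identity
  where
  identity : ∀ t x →
    x * (x * (x * (x * + 1))) + + 2 * (t * (t * + 1)) * (x * (x * + 1)) - + 8 * (t * (t * + 1)) * x
      + t * (t * (t * (t * + 1)))
      - t * (+ 4 * (x * (x * (x * + 1))) - + 4 * (t * (t * + 1)) * x + + 4 * (t * (t * + 1)))
    ≡ (x * x - + 2 * t * x - t * t) * (x * x - + 2 * t * x - t * t) - (+ 2 * t) * (+ 2 * t) * (+ 2 * x + t)
  identity = ℤ-Solver.solve-∀

d2P-root : ∀ t x .{{_ : ℤ.NonZero t}} → d2P t x ≡ + 0 →
  ∃ λ s → x * x - + 2 * t * x - t * t ≡ + 2 * t * s × s * s ≡ + 2 * x + t
d2P-root t x d≡0 = square-quotient _ (+ 2 * t) (+ 2 * x + t) {{ℤ.i*j≢0 (+ 2) t}}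
  (ℤ.i-j≡0⇒i≡j _ _ (trans (sym (d2P-difference-of-squares t x)) d≡0))

root-nonzero : ∀ {t x s} → t ≢ + 0 →
  x * x - + 2 * t * x - t * t ≡ + 2 * t * s → s * s ≡ + 2 * x + t → s ≢ + 0
root-nonzero {t} {x} t≢0 A≡2ts s²≡2x+t refl = t≢0 (begin
  t                           ≡⟨ ℤ-Solver.solve (t ∷ x ∷ []) ⟩
  (+ 2 * x + t) - + 2 * x     ≡⟨ cong₂ (λ u v → u - + 2 * v) (sym s²≡2x+t) x≡0 ⟩
  + 0 * + 0 - + 2 * + 0       ≡⟨⟩
  + 0                         ∎)
  where
  x≡0 : x ≡ + 0
  x≡0 = [ id , id ]′ (ℤ.i*j≡0⇒i≡0∨j≡0 x (begin
    x * x                                              ≡⟨ ℤ-Solver.solve (t ∷ x ∷ []) ⟩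
    (x * x - + 2 * t * x - t * t) + t * (+ 2 * x + t)  ≡⟨ cong₂ (λ a u → a + t * u) A≡2ts (sym s²≡2x+t) ⟩
    + 2 * t * + 0 + t * (+ 0 * + 0)                    ≡⟨ ℤ-Solver.solve (t ∷ []) ⟩
    + 0                                                ∎))

shifted-root-square : ∀ {t x s} → x * x - + 2 * t * x - t * t ≡ + 2 * t * s → s * s ≡ + 2 * x + t →
  (x + s * s + + 2 * s) * (x + s * s + + 2 * s) ≡ (s * s) * (+ 2 * (s + + 1) * (s + + 2))
shifted-root-square {t} {x} {s} A≡2ts s²≡2x+t = begin
  (x + s * s + + 2 * s) * (x + s * s + + 2 * s)
    ≡⟨ ℤ-Solver.solve (t ∷ x ∷ s ∷ []) ⟩
  (s * s) * (+ 2 * (s + + 1) * (s + + 2)) + ((x * x - + 2 * t * x - t * t) - + 2 * t * s)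
    - (s * s - (+ 2 * x + t)) * (s * s + t + + 2 * s)
    ≡⟨ cong₂ (λ a u → (s * s) * (+ 2 * (s + + 1) * (s + + 2)) + (a - + 2 * t * s)
                        - (u - (+ 2 * x + t)) * (s * s + t + + 2 * s)) A≡2ts s²≡2x+t ⟩
  (s * s) * (+ 2 * (s + + 1) * (s + + 2)) + (+ 2 * t * s - + 2 * t * s)
    - ((+ 2 * x + t) - (+ 2 * x + t)) * (s * s + t + + 2 * s)
    ≡⟨ ℤ-Solver.solve (t ∷ x ∷ s ∷ []) ⟩
  (s * s) * (+ 2 * (s + + 1) * (s + + 2))  ∎

shifted-root-pell : ∀ {s r} → r * r ≡ + 2 * (s + + 1) * (s + + 2) → nrm ((+ 2 * s + + 3) +√2· r) ≡ + 1
shifted-root-pell {s} {r} r²≡ = begin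
  (+ 2 * s + + 3) * (+ 2 * s + + 3) - + 2 * r * r                             ≡⟨ ℤ-Solver.solve (s ∷ r ∷ []) ⟩
  (+ 2 * s + + 3) * (+ 2 * s + + 3) - + 2 * (r * r)                           ≡⟨ cong (λ k → (+ 2 * s + + 3) * (+ 2 * s + + 3) - + 2 * k) r²≡ ⟩
  (+ 2 * s + + 3) * (+ 2 * s + + 3) - + 2 * (+ 2 * (s + + 1) * (s + + 2))     ≡⟨ ℤ-Solver.solve (s ∷ []) ⟩
  + 1                                                                         ∎

-- 4t = Φ (X + r√2) 1 for the unit of an integral point; Z is there so that 1 can be replaced
-- by ±nrm P once X + r√2 = ±γP².
Φ : ℤ√2 → ℤ → ℤ
Φ (X +√2· r) Z = (X - + 3 * Z) * (+ 3 * X - Z - + 4 * r)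

four-t≡Φ : ∀ {t x s r} → s * s ≡ + 2 * x + t → x + s * s + + 2 * s ≡ s * r →
  + 4 * t ≡ Φ ((+ 2 * s + + 3) +√2· r) (+ 1)
four-t≡Φ {t} {x} {s} {r} s²≡2x+t W≡sr = begin
  + 4 * t
    ≡⟨ ℤ-Solver.solve (t ∷ x ∷ s ∷ r ∷ []) ⟩
  (+ 2 * s + + 3 - + 3 * + 1) * (+ 3 * (+ 2 * s + + 3) - + 1 - + 4 * r)
    + + 8 * (s * r - (x + s * s + + 2 * s)) + + 4 * (t + + 2 * x - s * s)
    ≡⟨ cong₂ (λ w u → (+ 2 * s + + 3 - + 3 * + 1) * (+ 3 * (+ 2 * s + + 3) - + 1 - + 4 * r)
                        + + 8 * (w - (x + s * s + + 2 * s)) + + 4 * (t + + 2 * x - u)) (sym W≡sr) s²≡2x+t ⟩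
  (+ 2 * s + + 3 - + 3 * + 1) * (+ 3 * (+ 2 * s + + 3) - + 1 - + 4 * r)
    + + 8 * ((x + s * s + + 2 * s) - (x + s * s + + 2 * s)) + + 4 * (t + + 2 * x - (+ 2 * x + t))
    ≡⟨ ℤ-Solver.solve (t ∷ x ∷ s ∷ r ∷ []) ⟩
  (+ 2 * s + + 3 - + 3 * + 1) * (+ 3 * (+ 2 * s + + 3) - + 1 - + 4 * r)  ∎

integral-point⇒pell-unit : ∀ t x → t ≢ + 0 → d2P t x ≡ + 0 →
  ∃ λ w → nrm w ≡ + 1 × + 4 * t ≡ Φ w (+ 1)
integral-point⇒pell-unit t x t≢0 d≡0 = case d2P-root t x {{ℤ.≢-nonZero t≢0}} d≡0 of λ where
  (s , A≡2ts , s²≡2x+t) →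
    case square-quotient (x + s * s + + 2 * s) s (+ 2 * (s + + 1) * (s + + 2))
           {{ℤ.≢-nonZero (root-nonzero {t} {x} {s} t≢0 A≡2ts s²≡2x+t)}}
           (shifted-root-square {t} {x} {s} A≡2ts s²≡2x+t) of λ where
      (r , W≡sr , r²≡) → ((+ 2 * s + + 3) +√2· r) , shifted-root-pell {s} {r} r²≡ , four-t≡Φ {t} {x} {s} s²≡2x+t W≡sr

-- The four families

Φ-neg : ∀ {w} v Z → w ≡ neg v → Φ w Z ≡ Φ v (- Z)
Φ-neg (X +√2· r) Z refl = identity X r Z
  where
  identity : ∀ X r Z → (- X - + 3 * Z) * (+ 3 * (- X) - Z - + 4 * (- r))
                     ≡ (X - + 3 * (- Z)) * (+ 3 * X - - Z - + 4 * r)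
  identity = ℤ-Solver.solve-∀

quarter-Φ-at-nrm : ∀ {t} P → + 4 * t ≡ Φ (γ ⊗ (P ⊗ P)) (nrm P) →
  t ≡ + 4 * (+ 2 * re P * im P ^ 3 + + 3 * im P ^ 4)
quarter-Φ-at-nrm {t} (p +√2· q) 4t≡Φ = ℤ.*-cancelˡ-≡ (+ 4) t _ (trans 4t≡Φ (identity p q))
  where
  identity : ∀ p q →
    let A = p * p + + 2 * q * q ; B = p * q + q * p ; N = p * p - + 2 * q * q
        X = + 3 * A + + 4 * B   ; r = + 3 * B + + 2 * A
    in (X - + 3 * N) * (+ 3 * X - N - + 4 * r)
       ≡ + 4 * (+ 4 * (+ 2 * p * (q * (q * (q * + 1))) + + 3 * (q * (q * (q * (q * + 1))))))
  identity = ℤ-Solver.solve-∀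

quarter-Φ-at-neg-nrm : ∀ {t} P → + 4 * t ≡ Φ (γ ⊗ (P ⊗ P)) (- nrm P) →
  t ≡ + 4 * im P * re P ^ 3 + + 3 * re P ^ 4
quarter-Φ-at-neg-nrm {t} (p +√2· q) 4t≡Φ = ℤ.*-cancelˡ-≡ (+ 4) t _ (trans 4t≡Φ (identity p q))
  where
  identity : ∀ p q →
    let A = p * p + + 2 * q * q ; B = p * q + q * p ; N = p * p - + 2 * q * q
        X = + 3 * A + + 4 * B   ; r = + 3 * B + + 2 * A
    in (X - + 3 * (- N)) * (+ 3 * X - - N - + 4 * r)
       ≡ + 4 * (+ 4 * q * (p * (p * (p * + 1))) + + 3 * (p * (p * (p * (p * + 1)))))
  identity = ℤ-Solver.solve-∀

family₁ : ∀ {t w M} n → + 4 * t ≡ Φ w (+ 1) → M ≡ + 2 * n → w ≡ γ ⊗ (αpow M ⊗ αpow M) →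
  ∃ λ u → ∃ λ v → (ι (+ 2) ⊗ ι u ≡ αpow (+ 2 * n) ⊕ βpow (+ 2 * n))
                × (ι (+ 4) ⊗ √2 ⊗ ι v ≡ αpow (+ 2 * n) ⊖ βpow (+ 2 * n))
                × (t ≡ + 64 * (u * v ^ 3 + + 3 * v ^ 4))
family₁ {t} n 4t≡Φw refl w≡ = re P , h , twice-re , four-√2-h , t≡
  where
  P = αpow (+ 2 * n)
  h = re (αpow n) * im (αpow n)
  twice-re : ι (+ 2) ⊗ ι (re P) ≡ P ⊕ βpow (+ 2 * n)
  twice-re = trans (ι-⊗-ι (+ 2) (re P)) (sym (αpow-⊕-βpow (+ 2 * n)))
  four-√2-h : ι (+ 4) ⊗ √2 ⊗ ι h ≡ P ⊖ βpow (+ 2 * n)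
  four-√2-h = begin
    ι (+ 4) ⊗ √2 ⊗ ι h          ≡⟨ ι-⊗-√2-⊗-ι (+ 4) h ⟩
    √2 ⊗ ι (+ 4 * h)            ≡⟨ cong (λ k → √2 ⊗ ι k) (ℤ.*-assoc (+ 2) (+ 2) h) ⟩
    √2 ⊗ ι (+ 2 * (+ 2 * h))    ≡⟨ cong (λ k → √2 ⊗ ι (+ 2 * k)) (im-αpow-even n) ⟨
    √2 ⊗ ι (+ 2 * im P)         ≡⟨ αpow-⊖-βpow (+ 2 * n) ⟨
    P ⊖ βpow (+ 2 * n)          ∎
  t≡ : t ≡ + 64 * (re P * h ^ 3 + + 3 * h ^ 4)
  t≡ = begin
    t                                                       ≡⟨ quarter-Φ-at-nrm P (trans 4t≡Φw (cong₂ Φ w≡ (sym (nrm-αpow-even n)))) ⟩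
    + 4 * (+ 2 * re P * im P ^ 3 + + 3 * im P ^ 4)          ≡⟨ cong (λ q → + 4 * (+ 2 * re P * q ^ 3 + + 3 * q ^ 4)) (im-αpow-even n) ⟩
    + 4 * (+ 2 * re P * (+ 2 * h) ^ 3 + + 3 * (+ 2 * h) ^ 4) ≡⟨ rescale (re P) h ⟩
    + 64 * (re P * h ^ 3 + + 3 * h ^ 4)                     ∎
    where
    rescale : ∀ p h →
      + 4 * (+ 2 * p * (+ 2 * h * (+ 2 * h * (+ 2 * h * + 1))) + + 3 * (+ 2 * h * (+ 2 * h * (+ 2 * h * (+ 2 * h * + 1)))))
      ≡ + 64 * (p * (h * (h * (h * + 1))) + + 3 * (h * (h * (h * (h * + 1)))))
    rescale = ℤ-Solver.solve-∀

family₂ : ∀ {t w M} n → + 4 * t ≡ Φ w (+ 1) → M ≡ + 2 * n + + 1 → w ≡ neg (γ ⊗ (αpow M ⊗ αpow M)) →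
  ∃ λ u → ∃ λ v → (ι u ≡ αpow (+ 2 * n + + 1) ⊕ βpow (+ 2 * n + + 1))
                × (ι (+ 2) ⊗ √2 ⊗ ι v ≡ αpow (+ 2 * n + + 1) ⊖ βpow (+ 2 * n + + 1))
                × (t ≡ + 4 * (u * v ^ 3 + + 3 * v ^ 4))
family₂ n 4t≡Φw refl w≡ =
  + 2 * re P , im P ,
  sym (αpow-⊕-βpow M) ,
  trans (ι-⊗-√2-⊗-ι (+ 2) (im P)) (sym (αpow-⊖-βpow M)) ,
  quarter-Φ-at-nrm P (trans 4t≡Φw (trans (Φ-neg (γ ⊗ (P ⊗ P)) (+ 1) w≡) (cong (Φ (γ ⊗ (P ⊗ P))) (sym (nrm-αpow-odd n)))))
  where
  M = + 2 * n + + 1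
  P = αpow M

√2-family : ∀ {t} M → + 4 * t ≡ Φ (γ ⊗ (αpow M ⊗ αpow M)) (- nrm (αpow M)) →
  ∃ λ u → ∃ λ v → (ι u ≡ √2 ⊗ (αpow M ⊖ βpow M))
                × (ι (+ 2) ⊗ ι v ≡ αpow M ⊕ βpow M)
                × (t ≡ u * v ^ 3 + + 3 * v ^ 4)
√2-family M 4t≡Φ = + 4 * im P , re P , four-im , trans (ι-⊗-ι (+ 2) (re P)) (sym (αpow-⊕-βpow M)) ,
                   quarter-Φ-at-neg-nrm P 4t≡Φ
  where
  P = αpow M
  four-im : ι (+ 4 * im P) ≡ √2 ⊗ (P ⊖ βpow M)
  four-im = begin
    ι (+ 4 * im P)                ≡⟨ cong ι (ℤ.*-assoc (+ 2) (+ 2) (im P)) ⟩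
    ι (+ 2 * (+ 2 * im P))        ≡⟨ √2-⊗-√2-⊗-ι (+ 2 * im P) ⟨
    √2 ⊗ (√2 ⊗ ι (+ 2 * im P))    ≡⟨ cong (√2 ⊗_) (αpow-⊖-βpow M) ⟨
    √2 ⊗ (P ⊖ βpow M)             ∎

family₃ : ∀ {t w M} n → + 4 * t ≡ Φ w (+ 1) → M ≡ + 2 * n + + 1 → w ≡ γ ⊗ (αpow M ⊗ αpow M) →
  ∃ λ u → ∃ λ v → (ι u ≡ √2 ⊗ (αpow (+ 2 * n + + 1) ⊖ βpow (+ 2 * n + + 1)))
                × (ι (+ 2) ⊗ ι v ≡ αpow (+ 2 * n + + 1) ⊕ βpow (+ 2 * n + + 1))
                × (t ≡ u * v ^ 3 + + 3 * v ^ 4)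
family₃ n 4t≡Φw refl w≡ =
  √2-family (+ 2 * n + + 1) (trans 4t≡Φw (cong₂ Φ w≡ (cong -_ (sym (nrm-αpow-odd n)))))

family₄ : ∀ {t w M} n → + 4 * t ≡ Φ w (+ 1) → M ≡ + 2 * n → w ≡ neg (γ ⊗ (αpow M ⊗ αpow M)) →
  ∃ λ u → ∃ λ v → (ι u ≡ √2 ⊗ (αpow (+ 2 * n) ⊖ βpow (+ 2 * n)))
                × (ι (+ 2) ⊗ ι v ≡ αpow (+ 2 * n) ⊕ βpow (+ 2 * n))
                × (t ≡ u * v ^ 3 + + 3 * v ^ 4)
family₄ n 4t≡Φw refl w≡ = √2-family (+ 2 * n)
  (trans 4t≡Φw (trans (Φ-neg γP² (+ 1) w≡) (cong (λ ν → Φ γP² (- ν)) (sym (nrm-αpow-even n)))))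
  where
  γP² = γ ⊗ (αpow (+ 2 * n) ⊗ αpow (+ 2 * n))

proposition4p9 : (t₀ x₀ : ℤ) → d2P t₀ x₀ ≡ + 0 →
    (∃ λ (n : ℤ) → ∃ λ (u : ℤ) → ∃ λ (v : ℤ) →
        (ι (+ 2) ⊗ ι u ≡ αpow (+ 2 * n) ⊕ βpow (+ 2 * n))
      × (ι (+ 4) ⊗ √2 ⊗ ι v ≡ αpow (+ 2 * n) ⊖ βpow (+ 2 * n))
      × (t₀ ≡ + 64 * (u * v ^ 3 + + 3 * v ^ 4)))
  ⊎ (∃ λ (n : ℤ) → ∃ λ (u : ℤ) → ∃ λ (v : ℤ) →
        (ι u ≡ αpow (+ 2 * n + + 1) ⊕ βpow (+ 2 * n + + 1))
      × (ι (+ 2) ⊗ √2 ⊗ ι v ≡ αpow (+ 2 * n + + 1) ⊖ βpow (+ 2 * n + + 1))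
      × (t₀ ≡ + 4 * (u * v ^ 3 + + 3 * v ^ 4)))
  ⊎ (∃ λ (n : ℤ) → ∃ λ (u : ℤ) → ∃ λ (v : ℤ) →
        (ι u ≡ √2 ⊗ (αpow (+ 2 * n + + 1) ⊖ βpow (+ 2 * n + + 1)))
      × (ι (+ 2) ⊗ ι v ≡ αpow (+ 2 * n + + 1) ⊕ βpow (+ 2 * n + + 1))
      × (t₀ ≡ u * v ^ 3 + + 3 * v ^ 4))
  ⊎ (∃ λ (n : ℤ) → ∃ λ (u : ℤ) → ∃ λ (v : ℤ) →
        (ι u ≡ √2 ⊗ (αpow (+ 2 * n) ⊖ βpow (+ 2 * n)))
      × (ι (+ 2) ⊗ ι v ≡ αpow (+ 2 * n) ⊕ βpow (+ 2 * n))
      × (t₀ ≡ u * v ^ 3 + + 3 * v ^ 4))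
proposition4p9 t₀ x₀ d≡0 with t₀ ℤ.≟ + 0
... | yes t₀≡0 = inj₁ (+ 0 , + 1 , + 0 , refl , refl , t₀≡0)
... | no t₀≢0 = case integral-point⇒pell-unit t₀ x₀ t₀≢0 d≡0 of λ where
  (w , w-unit , 4t₀≡Φw) → case nrm≡1⇒±γ-square w w-unit of λ where
    (M , w≡±γP²) → case parity M ,′ w≡±γP² of λ where
      ((n , inj₁ M≡2n) , inj₁ w≡) → inj₁ (n , family₁ n 4t₀≡Φw M≡2n w≡)
      ((n , inj₂ M≡2n+1) , inj₂ w≡) → inj₂ (inj₁ (n , family₂ n 4t₀≡Φw M≡2n+1 w≡))
      ((n , inj₂ M≡2n+1) , inj₁ w≡) → inj₂ (inj₂ (inj₁ (n , family₃ n 4t₀≡Φw M≡2n+1 w≡)))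
      ((n , inj₁ M≡2n) , inj₂ w≡) → inj₂ (inj₂ (inj₂ (n , family₄ n 4t₀≡Φw M≡2n w≡)))
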